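{- Let $G$ be a group with a filtration $G_\bullet$ of finite degree, let $\Gamma\le G$, and let $X=(G/\Gamma,G_\bullet)$ be the corresponding coset nilspace. Let $n\ge1$, and for $c_0,c_1\in C^{n-1}(X)$ write $c_0\sim c_1$ if the map $\langle c_0,c_1\rangle_1:\{0,1\}^n\to X$, $(v,j)\mapsto c_j(v)$, belongs to $C^n(X)$. Then $c_0\sim c_1$ if and only if there exist $\tilde c_0,\tilde c_1\in C^{n-1}(G_\bullet)$ such that $c_i=\pi_\Gamma\circ\tilde c_i$ for $i=0,1$ and $\tilde c_0^{ -1}\tilde c_1\in C^{n-1}(G_\bullet^{+1})$. In particular, the equivalence classes of $\sim$ are the orbits of the action of $C^{n-1}(G_\bullet^{+1})$ on $C^{n-1}(X)$.
   Context: A filtration of degree at most $k$ on $G$ is $G=G_0=G_1\supseteq G_2\supseteq\cdots$ with $[G_i,G_j]\subseteq G_{i+j}$ and $G_{k+1}=\{1\}$. For a sequence $H_\bullet=(H_j)_{j\ge0}$ of subgroups, $C^n(H_\bullet)$ is the subgroup of $G^{\{0,1\}^n}$ generated by the maps $g^F$ with $F$ a face of $\{0,1\}^n$ (a set defined by fixing some coordinates) and $g\in H_{\mathrm{codim}F}$, where $g^F(v)=g$ for $v\in F$ and $1$ otherwise. $G_\bullet^{+1}$ is the shifted sequence with $j$-th term $G_{j+1}$. $\pi_\Gamma:G\to G/\Gamma$ is the quotient map. The coset nilspace $(G/\Gamma,G_\bullet)$ is the set $G/\Gamma$ with $C^n(X)=\{\pi_\Gamma\circ c: c\in C^n(G_\bullet)\}$;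 $C^{n-1}(G_\bullet)$ acts on $C^{n-1}(X)$ by pointwise left multiplication. -}

module Defs where

open import Level using (Level; _⊔_)
open import Algebra.Bundles using (Group)
open import Data.Nat using (ℕ; zero; suc; _+_)
open import Data.Bool using (Bool; true; false; if_then_else_; _∧_)
open import Data.Maybe using (Maybe; just; nothing)
open import Data.Vec using (Vec; []; _∷_; init; last)
open import Data.Product using (Σ; ∃; _×_; _,_)
open import Relation.Unary using (Pred; _⊆_)

-- The discrete cube {0,1}^n, with 0 = false, 1 = true.
Cube : ℕ → Set
Cube n = Vec Bool n

-- A face of {0,1}^n: for each coordinate, either free (nothing) or fixed (just b).
Face : ℕ → Set
Face n = Vec (Maybe Bool) n

codim : ∀ {n} → Face n → ℕ
codim [] = 0
codim (nothing ∷ F) = codim F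
codim (just _ ∷ F) = suc (codim F)

eqB : Bool → Bool → Bool
eqB true true = true
eqB false false = true
eqB _ _ = false

inFace : ∀ {n} → Face n → Cube n → Bool
inFace [] [] = true
inFace (nothing ∷ F) (_ ∷ v) = inFace F v
inFace (just b ∷ F) (x ∷ v) = eqB b x ∧ inFace F v

concat : ∀ {a} {A : Set a} {m} → (Cube m → A) → (Cube m → A) → Cube (suc m) → A
concat c₀ c₁ w = if last w then c₁ (init w) else c₀ (init w)

shift : ∀ {a p} {A : Set a} → (ℕ → Pred A p) → ℕ → Pred A p
shift H j = H (suc j)

module _ {c ℓ} (𝔾 : Group c ℓ) where
  open Group 𝔾

  record IsSubgroup {p} (H : Pred Carrier p) : Set (c ⊔ ℓ ⊔ p) where
    field
      resp : ∀ {x y} → x ≈ y → H x → H y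
      ε∈ : H ε
      ∙∈ : ∀ {x y} → H x → H y → H (x ∙ y)
      ⁻¹∈ : ∀ {x} → H x → H (x ⁻¹)

  commutator : Carrier → Carrier → Carrier
  commutator x y = ((x ⁻¹ ∙ y ⁻¹) ∙ x) ∙ y

  record IsFiltration {p} (k : ℕ) (Gᵢ : ℕ → Pred Carrier p) : Set (c ⊔ ℓ ⊔ p) where
    field
      subgroup : ∀ i → IsSubgroup (Gᵢ i)
      G₀-all : ∀ x → Gᵢ 0 x
      G₁-all : ∀ x → Gᵢ 1 x
      decreasing : ∀ i → Gᵢ (suc i) ⊆ Gᵢ i
      comm : ∀ i j {x y} → Gᵢ i x → Gᵢ j y → Gᵢ (i + j) (commutator x y)
      degree : ∀ {x} → Gᵢ (suc k) x → x ≈ ε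

  faceMap : ∀ {n} → Carrier → Face n → Cube n → Carrier
  faceMap g F v = if inFace F v then g else ε

  data CubeGrp {p} (H : ℕ → Pred Carrier p) (n : ℕ) : (Cube n → Carrier) → Set (c ⊔ ℓ ⊔ p) where
    gen : ∀ (F : Face n) {g} → H (codim F) g → CubeGrp H n (faceMap g F)
    one : CubeGrp H n (λ _ → ε)
    mul : ∀ {f h} → CubeGrp H n f → CubeGrp H n h → CubeGrp H n (λ v → f v ∙ h v)
    inv : ∀ {f} → CubeGrp H n f → CubeGrp H n (λ v → f v ⁻¹)
    resp : ∀ {f h} → (∀ v → f v ≈ h v) → CubeGrp H n f → CubeGrp H n h

  -- Coset space G/Γ: points of X are represented by elements of G,
  -- with x ≈Γ y iff xΓ = yΓ, i.e. x⁻¹y ∈ Γ.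
  module Coset {p} (Γ : Pred Carrier p) where
    _≈Γ_ : Carrier → Carrier → Set p
    x ≈Γ y = Γ (x ⁻¹ ∙ y)

    XCube : ∀ {q} (Gᵢ : ℕ → Pred Carrier q) (n : ℕ) → (Cube n → Carrier) → Set (c ⊔ ℓ ⊔ p ⊔ q)
    XCube Gᵢ n f = Σ (Cube n → Carrier) λ c̃ → CubeGrp Gᵢ n c̃ × (∀ v → c̃ v ≈Γ f v)

module Submission where

-- Conjugating a generator h^F' of C(G⁺) by a generator g^F of C(G) multiplies it by [h,g]^(F∩F'),
-- and [h,g] has degree codim F + codim F' + 1, so C(G) normalizes C(G⁺). With this, checking on
-- generators shows that c ↦ (c(·,0), c(·,0)⁻¹ c(·,1)) maps C^(m+1)(G) into C^m(G) × C^m(G⁺);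
-- conversely ⟨d₀, d₀ e⟩ with e ∈ C^m(G⁺) is the product of the lift of d₀ and the lift of e
-- supported on the upper facet. For the orbit form, note d₁ d₀⁻¹ = d₀ (d₀⁻¹ d₁) d₀⁻¹ ∈ C^m(G⁺).

open import Defs
open import Algebra.Bundles using (Group; CommutativeMonoid)
import Algebra.Properties.CommutativeSemigroup as CommutativeSemigroupProperties
import Algebra.Properties.Group as GroupProperties
open import Data.Bool using (Bool; true; false; if_then_else_; _∧_)
open import Data.Bool.Properties using (∧-commutativeMonoid; ∧-idem; ∧-identityʳ; ∧-zeroʳ; if-∧; if-eta)
open import Data.Maybe using (Maybe; just; nothing)
open import Data.Nat using (ℕ; suc; _+_; _≤_; _≤′_; ≤′-refl; ≤′-step; z≤n; s≤s)
open import Data.Nat.Properties using (+-commutativeSemigroup; +-mono-≤; ≤-refl; ≤⇒≤′; m≤n+m; module ≤-Reasoning)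
open import Data.Product using (Σ; _×_; _,_; proj₁)
open import Data.Vec using (Vec; []; _∷_; _∷ʳ_; init; last; initLast)
open import Data.Vec.Properties using (init-∷ʳ; last-∷ʳ)
open import Function using (id; _∘_)
open import Function.Bundles using (_⇔_; mk⇔)
open import Level using (_⊔_)
open import Relation.Binary.PropositionalEquality as ≡ using (_≡_; refl; cong; cong₂; subst; module ≡-Reasoning)
open import Relation.Unary using (Pred; _⊆_)

private
  module ∧ = CommutativeSemigroupProperties (CommutativeMonoid.commutativeSemigroup ∧-commutativeMonoid)
  module + = CommutativeSemigroupProperties +-commutativeSemigroup

∀-∷ʳ : ∀ {a b} {A : Set a} {n} {P : Vec A (suc n) → Set b} → (∀ v x → P (v ∷ʳ x)) → ∀ w → P w
∀-∷ʳ h w with initLast w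
... | v , x , refl = h v x

init-last-∷ʳ : ∀ {a b} {A : Set a} {B : Set b} {n} (f : Vec A n → A → B) v x → f (init (v ∷ʳ x)) (last (v ∷ʳ x)) ≡ f v x
init-last-∷ʳ f v x rewrite init-∷ʳ x v | last-∷ʳ x v = refl

concat-pointwise : ∀ {a r} {A : Set a} {m} (R : A → A → Set r) {a₀ a₁ b₀ b₁ : Cube m → A} →
  (∀ v → R (a₀ v) (b₀ v)) → (∀ v → R (a₁ v) (b₁ v)) → ∀ w → R (concat a₀ a₁ w) (concat b₀ b₁ w)
concat-pointwise R {a₀} {a₁} {b₀} {b₁} e₀ e₁ w = pointwise (last w) (init w)
  where
  pointwise : ∀ t u → R (if t then a₁ u else a₀ u) (if t then b₁ u else b₀ u)
  pointwise true u = e₁ u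
  pointwise false u = e₀ u

inCoord : Maybe Bool → Bool → Bool
inCoord nothing _ = true
inCoord (just b) x = eqB b x

codimCoord : Maybe Bool → ℕ
codimCoord nothing = 0
codimCoord (just _) = 1

inFace-∷ : ∀ {n} x (F : Face n) b v → inFace (x ∷ F) (b ∷ v) ≡ inCoord x b ∧ inFace F v
inFace-∷ nothing F b v = refl
inFace-∷ (just _) F b v = refl

codim-∷ : ∀ {n} x (F : Face n) → codim (x ∷ F) ≡ codimCoord x + codim F
codim-∷ nothing F = refl
codim-∷ (just _) F = refl

inFace-∷ʳ : ∀ {n} (F : Face n) x v b → inFace (F ∷ʳ x) (v ∷ʳ b) ≡ inCoord x b ∧ inFace F v
inFace-∷ʳ [] x [] b = inFace-∷ x [] b []
inFace-∷ʳ (y ∷ F) x (a ∷ v) b = begin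
  inFace (y ∷ (F ∷ʳ x)) (a ∷ (v ∷ʳ b))     ≡⟨ inFace-∷ y (F ∷ʳ x) a (v ∷ʳ b) ⟩
  inCoord y a ∧ inFace (F ∷ʳ x) (v ∷ʳ b)  ≡⟨ cong (inCoord y a ∧_) (inFace-∷ʳ F x v b) ⟩
  inCoord y a ∧ (inCoord x b ∧ inFace F v) ≡⟨ ∧.x∙yz≈y∙xz (inCoord y a) (inCoord x b) (inFace F v) ⟩
  inCoord x b ∧ (inCoord y a ∧ inFace F v) ≡⟨ cong (inCoord x b ∧_) (inFace-∷ y F a v) ⟨
  inCoord x b ∧ inFace (y ∷ F) (a ∷ v)    ∎
  where open ≡-Reasoning

codim-∷ʳ : ∀ {n} (F : Face n) x → codim (F ∷ʳ x) ≡ codimCoord x + codim F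
codim-∷ʳ [] x = codim-∷ x []
codim-∷ʳ (y ∷ F) x = begin
  codim (y ∷ (F ∷ʳ x))                     ≡⟨ codim-∷ y (F ∷ʳ x) ⟩
  codimCoord y + codim (F ∷ʳ x)            ≡⟨ cong (codimCoord y +_) (codim-∷ʳ F x) ⟩
  codimCoord y + (codimCoord x + codim F)  ≡⟨ +.x∙yz≈y∙xz (codimCoord y) (codimCoord x) (codim F) ⟩
  codimCoord x + (codimCoord y + codim F)  ≡⟨ cong (codimCoord x +_) (codim-∷ y F) ⟨
  codimCoord x + codim (y ∷ F)             ∎
  where open ≡-Reasoning

data Intersection {A V : Set} (mem : A → V → Bool) (dim : A → ℕ) (x y : A) : Set where
  disjoint : (∀ v → mem x v ∧ mem y v ≡ false) → Intersection mem dim x y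
  meet : ∀ z → dim z ≤ dim x + dim y → (∀ v → mem z v ≡ mem x v ∧ mem y v) → Intersection mem dim x y

coordIntersection : ∀ x y → Intersection inCoord codimCoord x y
coordIntersection nothing y = meet y ≤-refl (λ _ → refl)
coordIntersection (just b) nothing = meet (just b) (s≤s z≤n) (λ _ → ≡.sym (∧-identityʳ _))
coordIntersection (just true) (just true) = meet (just true) (s≤s z≤n) (λ _ → ≡.sym (∧-idem _))
coordIntersection (just false) (just false) = meet (just false) (s≤s z≤n) (λ _ → ≡.sym (∧-idem _))
coordIntersection (just true) (just false) = disjoint λ { true → refl ; false → refl }
coordIntersection (just false) (just true) = disjoint λ { true → refl ; false → refl }

inFace-∷-∧ : ∀ {n} x y (F F' : Face n) b v →
  inFace (x ∷ F) (b ∷ v) ∧ inFace (y ∷ F') (b ∷ v) ≡ (inCoord x b ∧ inCoord y b) ∧ (inFace F v ∧ inFace F' v)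
inFace-∷-∧ x y F F' b v = ≡.trans (cong₂ _∧_ (inFace-∷ x F b v) (inFace-∷ y F' b v)) (∧.interchange (inCoord x b) (inFace F v) (inCoord y b) (inFace F' v))

intersection-∷ : ∀ {n x y} {F F' : Face n} → Intersection inCoord codimCoord x y →
  Intersection inFace codim F F' → Intersection inFace codim (x ∷ F) (y ∷ F')
intersection-∷ {x = x} {y} {F} {F'} (disjoint p) _ =
  disjoint λ { (b ∷ v) → ≡.trans (inFace-∷-∧ x y F F' b v) (cong (_∧ (inFace F v ∧ inFace F' v)) (p b)) }
intersection-∷ {x = x} {y} {F} {F'} (meet _ _ _) (disjoint q) =
  disjoint λ { (b ∷ v) → ≡.trans (inFace-∷-∧ x y F F' b v) (≡.trans (cong ((inCoord x b ∧ inCoord y b) ∧_) (q v)) (∧-zeroʳ (inCoord x b ∧ inCoord y b))) }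
intersection-∷ {x = x} {y} {F} {F'} (meet z le e) (meet M le' e') = meet (z ∷ M) codim-bound inFace-meet
  where
  inFace-meet : ∀ w → inFace (z ∷ M) w ≡ inFace (x ∷ F) w ∧ inFace (y ∷ F') w
  inFace-meet (b ∷ v) = ≡.trans (inFace-∷ z M b v)
    (≡.trans (cong₂ _∧_ (e b) (e' v)) (≡.sym (inFace-∷-∧ x y F F' b v)))
  open ≤-Reasoning
  codim-bound : codim (z ∷ M) ≤ codim (x ∷ F) + codim (y ∷ F')
  codim-bound = begin
    codim (z ∷ M)                                         ≡⟨ codim-∷ z M ⟩
    codimCoord z + codim M                                ≤⟨ +-mono-≤ le le' ⟩
    (codimCoord x + codimCoord y) + (codim F + codim F')  ≡⟨ +.interchange (codimCoord x) (codimCoord y) (codim F) (codim F') ⟩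
    (codimCoord x + codim F) + (codimCoord y + codim F')  ≡⟨ cong₂ _+_ (codim-∷ x F) (codim-∷ y F') ⟨
    codim (x ∷ F) + codim (y ∷ F')                        ∎

faceIntersection : ∀ {n} (F F' : Face n) → Intersection inFace codim F F'
faceIntersection [] [] = meet [] z≤n (λ { [] → refl })
faceIntersection (x ∷ F) (y ∷ F') = intersection-∷ (coordIntersection x y) (faceIntersection F F')

module Conjugation {c ℓ} (𝔾 : Group c ℓ) where
  open Group 𝔾
  open GroupProperties 𝔾
  open import Relation.Binary.Reasoning.Setoid setoid

  conj : Carrier → Carrier → Carrier
  conj a x = (a \\ x) ∙ a

  conj-cong : ∀ {a a' x x'} → a ≈ a' → x ≈ x' → conj a x ≈ conj a' x'
  conj-cong a≈a' x≈x' = ∙-cong (∙-cong (⁻¹-cong a≈a') x≈x') a≈a'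

  conj-identityˡ : ∀ x → conj ε x ≈ x
  conj-identityˡ x = trans (identityʳ _) (trans (∙-congʳ ε⁻¹≈ε) (identityˡ x))

  conj-ε : ∀ a → conj a ε ≈ ε
  conj-ε a = trans (∙-congʳ (identityʳ _)) (inverseˡ a)

  conj-homo-∙ : ∀ a x y → conj a (x ∙ y) ≈ conj a x ∙ conj a y
  conj-homo-∙ a x y = begin
    (a ⁻¹ ∙ (x ∙ y)) ∙ a                  ≈⟨ assoc _ _ _ ⟩
    a ⁻¹ ∙ ((x ∙ y) ∙ a)                  ≈⟨ ∙-congˡ (assoc _ _ _) ⟩
    a ⁻¹ ∙ (x ∙ (y ∙ a))                  ≈⟨ assoc _ _ _ ⟨
    (a ⁻¹ ∙ x) ∙ (y ∙ a)                  ≈⟨ ∙-congˡ (\\-leftDividesˡ a (y ∙ a)) ⟨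
    (a ⁻¹ ∙ x) ∙ (a ∙ (a ⁻¹ ∙ (y ∙ a)))   ≈⟨ ∙-congˡ (∙-congˡ (assoc _ _ _)) ⟨
    (a ⁻¹ ∙ x) ∙ (a ∙ ((a ⁻¹ ∙ y) ∙ a))   ≈⟨ assoc _ _ _ ⟨
    conj a x ∙ conj a y                   ∎

  conj-homo-⁻¹ : ∀ a x → conj a (x ⁻¹) ≈ conj a x ⁻¹
  conj-homo-⁻¹ a x = begin
    (a ⁻¹ ∙ x ⁻¹) ∙ a          ≈⟨ assoc _ _ _ ⟩
    a ⁻¹ ∙ (x ⁻¹ ∙ a)          ≈⟨ ∙-congˡ (∙-congˡ (⁻¹-involutive a)) ⟨
    a ⁻¹ ∙ (x ⁻¹ ∙ a ⁻¹ ⁻¹)    ≈⟨ ∙-congˡ (⁻¹-anti-homo-∙ (a ⁻¹) x) ⟨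
    a ⁻¹ ∙ (a ⁻¹ ∙ x) ⁻¹       ≈⟨ ⁻¹-anti-homo-∙ _ _ ⟨
    ((a ⁻¹ ∙ x) ∙ a) ⁻¹        ∎

  conj-∙ : ∀ a b x → conj (a ∙ b) x ≈ conj b (conj a x)
  conj-∙ a b x = begin
    ((a ∙ b) ⁻¹ ∙ x) ∙ (a ∙ b)        ≈⟨ ∙-congʳ (∙-congʳ (⁻¹-anti-homo-∙ a b)) ⟩
    ((b ⁻¹ ∙ a ⁻¹) ∙ x) ∙ (a ∙ b)     ≈⟨ ∙-congʳ (assoc _ _ _) ⟩
    (b ⁻¹ ∙ (a ⁻¹ ∙ x)) ∙ (a ∙ b)     ≈⟨ assoc _ _ _ ⟩
    b ⁻¹ ∙ ((a ⁻¹ ∙ x) ∙ (a ∙ b))     ≈⟨ ∙-congˡ (assoc _ _ _) ⟨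
    b ⁻¹ ∙ (conj a x ∙ b)             ≈⟨ assoc _ _ _ ⟨
    conj b (conj a x)                 ∎

  conj-commutator : ∀ g h → conj g h ≈ h ∙ commutator 𝔾 h g
  conj-commutator g h = begin
    (g ⁻¹ ∙ h) ∙ g                       ≈⟨ assoc _ _ _ ⟩
    g ⁻¹ ∙ (h ∙ g)                       ≈⟨ \\-leftDividesˡ h _ ⟨
    h ∙ (h ⁻¹ ∙ (g ⁻¹ ∙ (h ∙ g)))        ≈⟨ ∙-congˡ (assoc _ _ _) ⟨
    h ∙ ((h ⁻¹ ∙ g ⁻¹) ∙ (h ∙ g))        ≈⟨ ∙-congˡ (assoc _ _ _) ⟨
    h ∙ (((h ⁻¹ ∙ g ⁻¹) ∙ h) ∙ g)        ∎

  conj-indicators : ∀ g h s t → conj (if s then g else ε) (if t then h else ε)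
                                ≈ (if t then h else ε) ∙ (if t ∧ s then commutator 𝔾 h g else ε)
  conj-indicators g h true true = conj-commutator g h
  conj-indicators g h true false = trans (conj-ε g) (sym (identityʳ ε))
  conj-indicators g h false true = trans (conj-identityˡ h) (sym (identityʳ h))
  conj-indicators g h false false = trans (conj-identityˡ ε) (sym (identityʳ ε))

  conj-⁻¹-\\ : ∀ a b → conj (a ⁻¹) (a \\ b) ≈ b // a
  conj-⁻¹-\\ a b = ∙-congʳ (trans (∙-congʳ (⁻¹-involutive a)) (\\-leftDividesˡ a b))

  \\-∙ : ∀ x y a b → (x ∙ a) \\ (y ∙ b) ≈ conj a (x \\ y) ∙ (a \\ b)
  \\-∙ x y a b = begin
    (x ∙ a) ⁻¹ ∙ (y ∙ b)                      ≈⟨ ∙-congʳ (⁻¹-anti-homo-∙ x a) ⟩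
    (a ⁻¹ ∙ x ⁻¹) ∙ (y ∙ b)                   ≈⟨ assoc _ _ _ ⟩
    a ⁻¹ ∙ (x ⁻¹ ∙ (y ∙ b))                   ≈⟨ ∙-congˡ (assoc _ _ _) ⟨
    a ⁻¹ ∙ ((x ⁻¹ ∙ y) ∙ b)                   ≈⟨ assoc _ _ _ ⟨
    (a ⁻¹ ∙ (x ⁻¹ ∙ y)) ∙ b                   ≈⟨ ∙-congˡ (\\-leftDividesˡ a b) ⟨
    (a ⁻¹ ∙ (x ⁻¹ ∙ y)) ∙ (a ∙ (a ⁻¹ ∙ b))    ≈⟨ assoc _ _ _ ⟨
    conj a (x \\ y) ∙ (a \\ b)                ∎

  \\-⁻¹ : ∀ x y → x ⁻¹ \\ y ⁻¹ ≈ conj (x ⁻¹) ((x \\ y) ⁻¹)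
  \\-⁻¹ x y = begin
    x ⁻¹ ⁻¹ ∙ y ⁻¹                          ≈⟨ ∙-congˡ (//-rightDividesʳ x (y ⁻¹)) ⟨
    x ⁻¹ ⁻¹ ∙ ((y ⁻¹ ∙ x) ∙ x ⁻¹)           ≈⟨ assoc _ _ _ ⟨
    (x ⁻¹ ⁻¹ ∙ (y ⁻¹ ∙ x)) ∙ x ⁻¹           ≈⟨ ∙-congʳ (∙-congˡ (∙-congˡ (⁻¹-involutive x))) ⟨
    (x ⁻¹ ⁻¹ ∙ (y ⁻¹ ∙ x ⁻¹ ⁻¹)) ∙ x ⁻¹     ≈⟨ ∙-congʳ (∙-congˡ (⁻¹-anti-homo-∙ (x ⁻¹) y)) ⟨
    (x ⁻¹ ⁻¹ ∙ (x ⁻¹ ∙ y) ⁻¹) ∙ x ⁻¹        ∎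

module CosetEquality {c ℓ q} (𝔾 : Group c ℓ) (Γ : Pred (Group.Carrier 𝔾) q) (Γ-subgroup : IsSubgroup 𝔾 Γ) where
  open Group 𝔾
  open GroupProperties 𝔾
  open Coset 𝔾 Γ
  open IsSubgroup Γ-subgroup renaming (resp to Γ-resp)

  ≈⇒≈Γ : ∀ {x y} → x ≈ y → x ≈Γ y
  ≈⇒≈Γ {x} x≈y = Γ-resp (trans (sym (inverseˡ x)) (∙-congˡ x≈y)) ε∈

  ≈Γ-sym : ∀ {x y} → x ≈Γ y → y ≈Γ x
  ≈Γ-sym {x} x≈Γy = Γ-resp (trans (⁻¹-anti-homo-∙ _ _) (∙-congˡ (⁻¹-involutive x))) (⁻¹∈ x≈Γy)

  ≈Γ-trans : ∀ {x y z} → x ≈Γ y → y ≈Γ z → x ≈Γ z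
  ≈Γ-trans {y = y} {z} x≈Γy y≈Γz = Γ-resp (trans (assoc _ _ _) (∙-congˡ (\\-leftDividesˡ y z))) (∙∈ x≈Γy y≈Γz)

  ≈Γ-∙ˡ : ∀ h {x y} → x ≈Γ y → (h ∙ x) ≈Γ (h ∙ y)
  ≈Γ-∙ˡ h {x} {y} = Γ-resp (sym (trans (∙-congʳ (⁻¹-anti-homo-∙ h x)) (trans (assoc _ _ _) (∙-congˡ (\\-leftDividesʳ h y)))))

module CubeGroups {c ℓ} (𝔾 : Group c ℓ) where
  open Group 𝔾 renaming (refl to ≈-refl)
  open GroupProperties 𝔾
  open Conjugation 𝔾

  CubeGrp-mono : ∀ {p q} {H : ℕ → Pred Carrier p} {H' : ℕ → Pred Carrier q} {m f} →
    (∀ {i} → H i ⊆ H' i) → CubeGrp 𝔾 H m f → CubeGrp 𝔾 H' m f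
  CubeGrp-mono H⊆H' (gen F h) = gen F (H⊆H' h)
  CubeGrp-mono H⊆H' one = one
  CubeGrp-mono H⊆H' (mul f h) = mul (CubeGrp-mono H⊆H' f) (CubeGrp-mono H⊆H' h)
  CubeGrp-mono H⊆H' (inv f) = inv (CubeGrp-mono H⊆H' f)
  CubeGrp-mono H⊆H' (resp e f) = resp e (CubeGrp-mono H⊆H' f)

  faceMap-⁻¹ : ∀ {m} (F : Face m) g v → faceMap 𝔾 (g ⁻¹) F v ≈ faceMap 𝔾 g F v ⁻¹
  faceMap-⁻¹ F g v with inFace F v
  ... | true = ≈-refl
  ... | false = sym ε⁻¹≈ε

  faceMap-∷ʳ : ∀ {m} g (F : Face m) x v b → faceMap 𝔾 g (F ∷ʳ x) (v ∷ʳ b) ≡ (if inCoord x b then faceMap 𝔾 g F v else ε)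
  faceMap-∷ʳ g F x v b = ≡.trans (cong (λ t → if t then g else ε) (inFace-∷ʳ F x v b)) (if-∧ (inCoord x b))

  if-ε-∙ : ∀ t {x y} → (if t then x else ε) ∙ (if t then y else ε) ≈ (if t then x ∙ y else ε)
  if-ε-∙ true = ≈-refl
  if-ε-∙ false = identityʳ ε

  if-ε-⁻¹ : ∀ t {x} → (if t then x else ε) ⁻¹ ≈ (if t then x ⁻¹ else ε)
  if-ε-⁻¹ true = ≈-refl
  if-ε-⁻¹ false = ε⁻¹≈ε

  if-ε-cong : ∀ t {x y} → x ≈ y → (if t then x else ε) ≈ (if t then y else ε)
  if-ε-cong true x≈y = x≈y
  if-ε-cong false _ = ≈-refl

  extend : ∀ {m} → Maybe Bool → (Cube m → Carrier) → Cube (suc m) → Carrier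
  extend x a w = if inCoord x (last w) then a (init w) else ε

  CubeGrp-extend : ∀ {p q} {H : ℕ → Pred Carrier p} {H' : ℕ → Pred Carrier q} {m a} x →
    (∀ {i} → H i ⊆ H' (codimCoord x + i)) → CubeGrp 𝔾 H m a → CubeGrp 𝔾 H' (suc m) (extend x a)
  CubeGrp-extend {H' = H'} x H⊆H' (gen F {g} h) =
    resp (∀-∷ʳ extend-faceMap) (gen (F ∷ʳ x) (subst (λ i → H' i g) (≡.sym (codim-∷ʳ F x)) (H⊆H' h)))
    where
    extend-faceMap : ∀ v b → faceMap 𝔾 g (F ∷ʳ x) (v ∷ʳ b) ≈ extend x (faceMap 𝔾 g F) (v ∷ʳ b)
    extend-faceMap v b = reflexive (≡.trans (faceMap-∷ʳ g F x v b)
      (≡.sym (init-last-∷ʳ (λ u t → if inCoord x t then faceMap 𝔾 g F u else ε) v b)))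
  CubeGrp-extend x H⊆H' one = resp (λ w → reflexive (≡.sym (if-eta (inCoord x (last w))))) one
  CubeGrp-extend x H⊆H' (mul f h) =
    resp (λ w → if-ε-∙ (inCoord x (last w))) (mul (CubeGrp-extend x H⊆H' f) (CubeGrp-extend x H⊆H' h))
  CubeGrp-extend x H⊆H' (inv f) = resp (λ w → if-ε-⁻¹ (inCoord x (last w))) (inv (CubeGrp-extend x H⊆H' f))
  CubeGrp-extend x H⊆H' (resp e f) = resp (λ w → if-ε-cong (inCoord x (last w)) (e (init w))) (CubeGrp-extend x H⊆H' f)

  module Decreasing {p} {H : ℕ → Pred Carrier p} (H-decreasing : ∀ i → H (suc i) ⊆ H i) where

    antitone : ∀ {i j} → i ≤ j → H j ⊆ H i
    antitone = antitone′ ∘ ≤⇒≤′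
      where
      antitone′ : ∀ {i j} → i ≤′ j → H j ⊆ H i
      antitone′ ≤′-refl = id
      antitone′ (≤′-step i≤′j) = antitone′ i≤′j ∘ H-decreasing _

    CubeGrp-restrict : ∀ {m f} b → CubeGrp 𝔾 H (suc m) f → CubeGrp 𝔾 H m (λ v → f (v ∷ʳ b))
    CubeGrp-restrict {m} b (gen F {g} h) with initLast F
    ... | F' , x , refl = resp (λ v → reflexive (≡.sym (faceMap-∷ʳ g F' x v b)))
                               (onlyIf (inCoord x b) (antitone (m≤n+m _ (codimCoord x)) (subst (λ i → H i g) (codim-∷ʳ F' x) h)))
      where
      onlyIf : ∀ t → H (codim F') g → CubeGrp 𝔾 H m (λ v → if t then faceMap 𝔾 g F' v else ε)
      onlyIf true h' = gen F' h'
      onlyIf false _ = one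
    CubeGrp-restrict b one = one
    CubeGrp-restrict b (mul f h) = mul (CubeGrp-restrict b f) (CubeGrp-restrict b h)
    CubeGrp-restrict b (inv f) = inv (CubeGrp-restrict b f)
    CubeGrp-restrict b (resp e f) = resp (λ v → e (v ∷ʳ b)) (CubeGrp-restrict b f)

    CubeGrp-intersection : ∀ {m} (F F' : Face m) {x} → H (codim F + codim F') x →
      CubeGrp 𝔾 H m (λ v → if inFace F v ∧ inFace F' v then x else ε)
    CubeGrp-intersection F F' {x} h with faceIntersection F F'
    ... | disjoint F∩F'≡∅ = resp (λ v → reflexive (cong (λ t → if t then x else ε) (≡.sym (F∩F'≡∅ v)))) one
    ... | meet M M≤ M≡F∩F' = resp (λ v → reflexive (cong (λ t → if t then x else ε) (M≡F∩F' v))) (gen M (antitone M≤ h))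

  module Filtered {k p} {Gᵢ : ℕ → Pred Carrier p} (filtration : IsFiltration 𝔾 k Gᵢ) where
    open IsFiltration filtration
    open Decreasing decreasing
    module Shifted = Decreasing (decreasing ∘ suc)

    C C⁺ : ∀ m → Pred (Cube m → Carrier) (c ⊔ ℓ ⊔ p)
    C = CubeGrp 𝔾 Gᵢ
    C⁺ = CubeGrp 𝔾 (shift Gᵢ)

    C⁺⊆C : ∀ {m} → C⁺ m ⊆ C m
    C⁺⊆C = CubeGrp-mono (decreasing _)

    Normalizes : ∀ {m} → (Cube m → Carrier) → Set (c ⊔ ℓ ⊔ p)
    Normalizes {m} a = ∀ {b} → C⁺ m b → C⁺ m (λ v → conj (a v) (b v))

    normalizes-generators : ∀ {m a} →
      (∀ F {h} → shift Gᵢ (codim F) h → C⁺ m (λ v → conj (a v) (faceMap 𝔾 h F v))) → Normalizes a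
    normalizes-generators {a = a} normalizes-gen = go
      where
      go : Normalizes a
      go (gen F h) = normalizes-gen F h
      go one = resp (λ v → sym (conj-ε (a v))) one
      go (mul f h) = resp (λ v → sym (conj-homo-∙ (a v) _ _)) (mul (go f) (go h))
      go (inv f) = resp (λ v → sym (conj-homo-⁻¹ (a v) _)) (inv (go f))
      go (resp e f) = resp (λ v → conj-cong ≈-refl (e v)) (go f)

    normalizes-resp : ∀ {m} {a a' : Cube m → Carrier} → (∀ v → a v ≈ a' v) → Normalizes a → Normalizes a'
    normalizes-resp a≈a' N b = resp (λ v → conj-cong (a≈a' v) ≈-refl) (N b)

    normalizes-ε : ∀ {m} → Normalizes {m} (λ _ → ε)
    normalizes-ε = resp (λ v → sym (conj-identityˡ _))

    normalizes-∙ : ∀ {m} {a a' : Cube m → Carrier} → Normalizes a → Normalizes a' → Normalizes (λ v → a v ∙ a' v)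
    normalizes-∙ N N' b = resp (λ v → sym (conj-∙ _ _ _)) (N' (N b))

    -- (g^F)⁻¹ h^F' g^F = h^F' [h,g]^(F∩F'), and [h,g] ∈ G_(codim F' + codim F + 1) ⊆ G_(codim (F∩F') + 1).
    faceMap-normalizes : ∀ {m} (F : Face m) {g} → Gᵢ (codim F) g → Normalizes (faceMap 𝔾 g F)
    faceMap-normalizes F {g} g∈G = normalizes-generators λ F' {h} h∈G⁺ →
      resp (λ v → sym (conj-indicators g h (inFace F v) (inFace F' v)))
           (mul (gen F' h∈G⁺) (Shifted.CubeGrp-intersection F' F (comm (suc (codim F')) (codim F) h∈G⁺ g∈G)))

    C-normalizes : ∀ {m a} → C m a → Normalizes a
    C-normalizes = proj₁ ∘ normalizes±
      where
      normalizes± : ∀ {m a} → C m a → Normalizes a × Normalizes (λ v → a v ⁻¹)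
      normalizes± (gen F g) =
        faceMap-normalizes F g , normalizes-resp (faceMap-⁻¹ F _) (faceMap-normalizes F (IsSubgroup.⁻¹∈ (subgroup _) g))
      normalizes± one = normalizes-ε , normalizes-resp (λ _ → sym ε⁻¹≈ε) normalizes-ε
      normalizes± (mul f h) with normalizes± f | normalizes± h
      ... | Nf , Nf⁻¹ | Nh , Nh⁻¹ =
        normalizes-∙ Nf Nh , normalizes-resp (λ v → sym (⁻¹-anti-homo-∙ _ _)) (normalizes-∙ Nh⁻¹ Nf⁻¹)
      normalizes± (inv f) with normalizes± f
      ... | Nf , Nf⁻¹ = Nf⁻¹ , normalizes-resp (λ v → sym (⁻¹-involutive _)) Nf
      normalizes± (resp e f) with normalizes± f
      ... | Nf , Nf⁻¹ = normalizes-resp e Nf , normalizes-resp (λ v → ⁻¹-cong (e v)) Nf⁻¹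

    C-derivative : ∀ {m f} → C (suc m) f → C⁺ m (λ v → f (v ∷ʳ false) \\ f (v ∷ʳ true))
    C-derivative {m} (gen F {g} g∈G) with initLast F
    ... | F' , x , refl =
      resp (λ v → ∙-cong (⁻¹-cong (reflexive (≡.sym (faceMap-∷ʳ g F' x v false)))) (reflexive (≡.sym (faceMap-∷ʳ g F' x v true))))
           (derivative x (subst (λ i → Gᵢ i g) (codim-∷ʳ F' x) g∈G))
      where
      φ : Cube m → Carrier
      φ = faceMap 𝔾 g F'
      derivative : ∀ x → Gᵢ (codimCoord x + codim F') g →
        C⁺ m (λ v → (if inCoord x false then φ v else ε) \\ (if inCoord x true then φ v else ε))
      derivative nothing _ = resp (λ v → sym (inverseˡ (φ v))) one
      derivative (just true) g∈G⁺ = resp (λ v → sym (trans (∙-congʳ ε⁻¹≈ε) (identityˡ (φ v)))) (gen F' g∈G⁺)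
      derivative (just false) g∈G⁺ =
        resp (λ v → trans (faceMap-⁻¹ F' g v) (sym (identityʳ (φ v ⁻¹)))) (gen F' (IsSubgroup.⁻¹∈ (subgroup _) g∈G⁺))
    C-derivative one = resp (λ _ → sym (inverseˡ ε)) one
    C-derivative (mul f h) =
      resp (λ v → sym (\\-∙ _ _ _ _)) (mul (C-normalizes (CubeGrp-restrict false h) (C-derivative f)) (C-derivative h))
    C-derivative (inv f) =
      resp (λ v → sym (\\-⁻¹ _ _)) (C-normalizes (inv (CubeGrp-restrict false f)) (inv (C-derivative f)))
    C-derivative (resp e f) = resp (λ v → ∙-cong (⁻¹-cong (e _)) (e _)) (C-derivative f)

    C-concat : ∀ {m d₀ d₁} → C m d₀ → C⁺ m (λ v → d₀ v \\ d₁ v) → C (suc m) (concat d₀ d₁)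
    C-concat {d₀ = d₀} {d₁} d₀∈C d₀\\d₁∈C⁺ =
      resp (λ w → split (last w) (init w))
           (mul (CubeGrp-extend nothing id d₀∈C) (CubeGrp-extend {H = shift Gᵢ} (just true) id d₀\\d₁∈C⁺))
      where
      split : ∀ t u → d₀ u ∙ (if inCoord (just true) t then d₀ u \\ d₁ u else ε) ≈ (if t then d₁ u else d₀ u)
      split true u = \\-leftDividesˡ (d₀ u) (d₁ u)
      split false u = identityʳ (d₀ u)

    module CosetCubes {q} {Γ : Pred Carrier q} (Γ-subgroup : IsSubgroup 𝔾 Γ) where
      open Coset 𝔾 Γ
      open CosetEquality 𝔾 Γ Γ-subgroup

      LiftsDiffer : ∀ {m} → (c₀ c₁ : Cube m → Carrier) → Set (c ⊔ ℓ ⊔ p ⊔ q)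
      LiftsDiffer {m} c₀ c₁ = Σ (Cube m → Carrier) λ d₀ → Σ (Cube m → Carrier) λ d₁ →
        C m d₀ × C m d₁ × (∀ v → d₀ v ≈Γ c₀ v) × (∀ v → d₁ v ≈Γ c₁ v) × C⁺ m (λ v → d₀ v \\ d₁ v)

      InOrbit : ∀ {m} → (c₀ c₁ : Cube m → Carrier) → Set (c ⊔ ℓ ⊔ p ⊔ q)
      InOrbit {m} c₀ c₁ = Σ (Cube m → Carrier) λ h → C⁺ m h × (∀ v → (h v ∙ c₀ v) ≈Γ c₁ v)

      concat-cube⇒liftsDiffer : ∀ {m c₀ c₁} → XCube Gᵢ (suc m) (concat c₀ c₁) → LiftsDiffer c₀ c₁
      concat-cube⇒liftsDiffer {c₀ = c₀} {c₁} (c̃ , c̃∈C , c̃≈Γ) =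
        (λ v → c̃ (v ∷ʳ false)) , (λ v → c̃ (v ∷ʳ true)) , CubeGrp-restrict false c̃∈C , CubeGrp-restrict true c̃∈C ,
        c̃≈Γ-at false , c̃≈Γ-at true , C-derivative c̃∈C
        where
        c̃≈Γ-at : ∀ b v → c̃ (v ∷ʳ b) ≈Γ (if b then c₁ v else c₀ v)
        c̃≈Γ-at b v = subst (c̃ (v ∷ʳ b) ≈Γ_) (init-last-∷ʳ (λ u t → if t then c₁ u else c₀ u) v b) (c̃≈Γ (v ∷ʳ b))

      liftsDiffer⇒concat-cube : ∀ {m c₀ c₁} → LiftsDiffer c₀ c₁ → XCube Gᵢ (suc m) (concat c₀ c₁)
      liftsDiffer⇒concat-cube (d₀ , d₁ , d₀∈C , _ , d₀≈Γ , d₁≈Γ , d₀\\d₁∈C⁺) =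
        concat d₀ d₁ , C-concat d₀∈C d₀\\d₁∈C⁺ , concat-pointwise _≈Γ_ d₀≈Γ d₁≈Γ

      liftsDiffer⇒inOrbit : ∀ {m c₀ c₁} → LiftsDiffer {m} c₀ c₁ → InOrbit c₀ c₁
      liftsDiffer⇒inOrbit (d₀ , d₁ , d₀∈C , _ , d₀≈Γ , d₁≈Γ , d₀\\d₁∈C⁺) =
        (λ v → d₁ v // d₀ v) ,
        resp (λ v → conj-⁻¹-\\ (d₀ v) (d₁ v)) (C-normalizes (inv d₀∈C) d₀\\d₁∈C⁺) ,
        λ v → ≈Γ-trans (≈Γ-∙ˡ (d₁ v // d₀ v) (≈Γ-sym (d₀≈Γ v)))
                       (≈Γ-trans (≈⇒≈Γ (//-rightDividesˡ (d₀ v) (d₁ v))) (d₁≈Γ v))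

      inOrbit⇒liftsDiffer : ∀ {m c₀ c₁} → XCube Gᵢ m c₀ → InOrbit c₀ c₁ → LiftsDiffer c₀ c₁
      inOrbit⇒liftsDiffer (c̃ , c̃∈C , c̃≈Γ) (h , h∈C⁺ , hc₀≈Γ) =
        c̃ , (λ v → h v ∙ c̃ v) , c̃∈C , mul (C⁺⊆C h∈C⁺) c̃∈C , c̃≈Γ ,
        (λ v → ≈Γ-trans (≈Γ-∙ˡ (h v) (c̃≈Γ v)) (hc₀≈Γ v)) ,
        resp (λ v → assoc _ _ _) (C-normalizes c̃∈C h∈C⁺)

lemma3p7 : ∀ {c ℓ p} (𝔾 : Group c ℓ) → let open Group 𝔾 in
    (k : ℕ) (Gᵢ : ℕ → Pred Carrier p) → IsFiltration 𝔾 k Gᵢ →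
    (Γ : Pred Carrier p) → IsSubgroup 𝔾 Γ → let open Coset 𝔾 Γ in
    (m : ℕ) (c₀ c₁ : Cube m → Carrier) → XCube Gᵢ m c₀ → XCube Gᵢ m c₁ →
    (XCube Gᵢ (suc m) (concat c₀ c₁)
      ⇔ Σ (Cube m → Carrier) λ d₀ → Σ (Cube m → Carrier) λ d₁ →
          CubeGrp 𝔾 Gᵢ m d₀ × CubeGrp 𝔾 Gᵢ m d₁
          × (∀ v → d₀ v ≈Γ c₀ v) × (∀ v → d₁ v ≈Γ c₁ v)
          × CubeGrp 𝔾 (shift Gᵢ) m (λ v → d₀ v ⁻¹ ∙ d₁ v))
    × (XCube Gᵢ (suc m) (concat c₀ c₁)
      ⇔ Σ (Cube m → Carrier) λ h →
          CubeGrp 𝔾 (shift Gᵢ) m h × (∀ v → (h v ∙ c₀ v) ≈Γ c₁ v))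
lemma3p7 𝔾 k Gᵢ filtration Γ Γ-subgroup m c₀ c₁ c₀-cube _ =
  mk⇔ concat-cube⇒liftsDiffer liftsDiffer⇒concat-cube ,
  mk⇔ (liftsDiffer⇒inOrbit ∘ concat-cube⇒liftsDiffer) (liftsDiffer⇒concat-cube ∘ inOrbit⇒liftsDiffer c₀-cube)
  where open CubeGroups.Filtered.CosetCubes 𝔾 filtration Γ-subgroup
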